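{- Let $K$ be any field and let $e_1,e_2,e_3$ be the standard basis of $K^3$. Then the tensor $$\det_3=\sum_{\sigma\in\Sigma_3}\operatorname{sgn}(\sigma)\, e_{\sigma(1)}\otimes e_{\sigma(2)}\otimes e_{\sigma(3)}\in K^3\otimes K^3\otimes K^3$$ has tensor rank exactly $5$.
   Context: $\Sigma_3$ is the symmetric group on three letters. A simple (rank $1$) tensor is one of the form $v_1\otimes v_2\otimes v_3$. The tensor rank $\operatorname{trk}(T)$ of $T$ is the smallest integer $r$ such that $T$ is a sum of $r$ simple tensors. -}

module Defs where

open import Level using (Level; _⊔_)
open import Algebra.Bundles using (CommutativeRing)
open import Data.Nat using (ℕ; _<_)
open import Data.Fin using (Fin; zero; suc)
open import Data.Product using (Σ; ∃; _×_; _,_)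
open import Relation.Nullary using (¬_)

record Field (c ℓ : Level) : Set (Level.suc (c ⊔ ℓ)) where
  field
    commRing : CommutativeRing c ℓ
  open CommutativeRing commRing public
  field
    0≉1     : ¬ (0# ≈ 1#)
    inverse : ∀ x → ¬ (x ≈ 0#) → Σ Carrier λ y → x * y ≈ 1#

module TensorDefs {c ℓ : Level} (K : Field c ℓ) where
  open Field K using (Carrier; _≈_; _+_; _*_; -_; 0#; 1#)

  Vec3 : Set c
  Vec3 = Fin 3 → Carrier

  Tensor : Set c
  Tensor = Fin 3 → Fin 3 → Fin 3 → Carrier

  _≋_ : Tensor → Tensor → Set ℓ
  S ≋ T = ∀ i j k → S i j k ≈ T i j k

  _⊕_ : Tensor → Tensor → Tensor
  (S ⊕ T) i j k = S i j k + T i j k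

  ⊖_ : Tensor → Tensor
  (⊖ T) i j k = - T i j k

  zeroT : Tensor
  zeroT _ _ _ = 0#

  _⊗_⊗_ : Vec3 → Vec3 → Vec3 → Tensor
  (u ⊗ v ⊗ w) i j k = u i * v j * w k

  -- indices 1, 2, 3 of the paper (Fin 3 is 0-based)
  i₁ i₂ i₃ : Fin 3
  i₁ = zero
  i₂ = suc zero
  i₃ = suc (suc zero)

  e : Fin 3 → Vec3
  e zero    zero          = 1#
  e (suc zero) (suc zero) = 1#
  e (suc (suc zero)) (suc (suc zero)) = 1#
  e _ _ = 0#

  sumSimple : (r : ℕ) → (Fin r → Vec3) → (Fin r → Vec3) → (Fin r → Vec3) → Tensor
  sumSimple ℕ.zero    a b c = zeroT
  sumSimple (ℕ.suc r) a b c = (a zero ⊗ b zero ⊗ c zero) ⊕ sumSimple r (λ t → a (suc t)) (λ t → b (suc t)) (λ t → c (suc t))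

  SumOfSimple : ℕ → Tensor → Set (c ⊔ ℓ)
  SumOfSimple r T = Σ (Fin r → Vec3) λ a → Σ (Fin r → Vec3) λ b → Σ (Fin r → Vec3) λ c' → T ≋ sumSimple r a b c'

  HasTensorRank : Tensor → ℕ → Set (c ⊔ ℓ)
  HasTensorRank T r = SumOfSimple r T × (∀ s → s < r → ¬ SumOfSimple s T)

  det₃ : Tensor
  det₃ = (e i₁ ⊗ e i₂ ⊗ e i₃)
       ⊕ ((⊖ (e i₁ ⊗ e i₃ ⊗ e i₂))
       ⊕ ((⊖ (e i₂ ⊗ e i₁ ⊗ e i₃))
       ⊕ ((e i₂ ⊗ e i₃ ⊗ e i₁)
       ⊕ ((e i₃ ⊗ e i₁ ⊗ e i₂)
       ⊕ (⊖ (e i₃ ⊗ e i₂ ⊗ e i₁))))))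

module Submission where

-- The upper bound is an explicit five-term identity for det(x,y,z) = [x,y,z].
-- For the lower bound, det₃ is a sum of simple tensors aₜ ⊗ bₜ ⊗ cₜ iff
-- [x,y,z] = Σₜ (x·aₜ)(y·bₜ)(z·cₜ) for all x, y, z.  For fixed x, [x,-,-] is an
-- alternating bilinear form; if it has rank one then x = 0, and if it is a sum of two
-- rank-one forms f₁g₁ + f₂g₂ with x ≠ 0 then f₂(x) = 0 (else [x,x,-] = 0 makes g₂
-- proportional to g₁).  Given four terms with a₀, a₁, a₂ independent, x = aᵢ ⨯ aⱼ
-- kills two of them, so b₃ is orthogonal to a₀ ⨯ a₁, a₁ ⨯ a₂, a₂ ⨯ a₀; these span K³,
-- so b₃ = 0 and [a₀ ⨯ a₁,-,-] has rank one.
-- If every three of the aₜ are dependent, each aₜ ⨯ aᵤ and then each aₜ is orthogonal to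
-- all vectors, so [x,y,z] = 0 identically.

open import Defs
open import Level using (Level; _⊔_)
open import Algebra.Bundles using (CommutativeRing)
open import Algebra.Bundles.Raw using (RawRing)
open import Algebra.Solver.Ring.AlmostCommutativeRing
  using (fromCommutativeRing; _-Raw-AlmostCommutative⟶_)
open import Data.Empty using (⊥)
open import Data.Fin.Base using (Fin; zero; suc; _↑ˡ_; _↑ʳ_)
open import Data.Fin.Patterns using (0F; 1F; 2F; 3F; 4F; 5F)
open import Data.Integer.Base as ℤ using (ℤ; +_; -[1+_]; _⊖_; sign; ∣_∣; _◃_)
import Data.Integer.Properties as ℤ
open import Data.Maybe.Base using (Maybe; just; nothing)
open import Data.Nat.Base as ℕ using (ℕ; _<_; _≤′_; ≤′-refl; ≤′-step; s≤s⁻¹)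
open import Data.Nat.Properties using (≤⇒≤′; +-suc)
open import Data.Product.Base using (_,_)
open import Data.Sign.Base as Sign using (Sign)
open import Data.Vec.Base using (Vec; []; _∷_)
open import Function.Base using (_∘_)
open import Relation.Binary.PropositionalEquality.Core as ≡ using (_≡_)
open import Relation.Nullary.Decidable.Core using (yes; no; ¬¬-excluded-middle)
open import Relation.Nullary.Negation.Core using (¬_)

module Vector3 {r ℓ} (R : RawRing r ℓ) where
  open RawRing R

  Vector : Set r
  Vector = Fin 3 → Carrier

  ⟨_,_,_⟩ : Carrier → Carrier → Carrier → Vector
  ⟨ x , y , z ⟩ 0F = x
  ⟨ x , y , z ⟩ 1F = y
  ⟨ x , y , z ⟩ 2F = z

  infixl 7 _·_
  _·_ : Vector → Vector → Carrier
  u · v = u 0F * v 0F + u 1F * v 1F + u 2F * v 2F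

  infixl 8 _⨯_
  _⨯_ : Vector → Vector → Vector
  (u ⨯ v) 0F = u 1F * v 2F + - (u 2F * v 1F)
  (u ⨯ v) 1F = u 2F * v 0F + - (u 0F * v 2F)
  (u ⨯ v) 2F = u 0F * v 1F + - (u 1F * v 0F)

  [_,_,_] : Vector → Vector → Vector → Carrier
  [ u , v , w ] = (u ⨯ v) · w

  termSum : (n : ℕ) (a b c : Fin n → Vector) → Vector → Vector → Vector → Carrier
  termSum ℕ.zero    a b c x y z = 0#
  termSum (ℕ.suc n) a b c x y z =
    (x · a zero) * (y · b zero) * (z · c zero) + termSum n (a ∘ suc) (b ∘ suc) (c ∘ suc) x y z

  -- [x,y,z] = −x₁y₃(z₂−z₃) + (x₁−x₂)(y₂−y₃)z₃ + (x₃−x₂)(y₁−y₂)z₁ + x₂(y₁−y₂+y₃)(z₁−z₃) − x₃y₁(z₁−z₂)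
  five₁ five₂ five₃ : Fin 5 → Vector
  five₁ 0F = ⟨ - 1# , 0# , 0# ⟩
  five₁ 1F = ⟨ 1# , - 1# , 0# ⟩
  five₁ 2F = ⟨ 0# , - 1# , 1# ⟩
  five₁ 3F = ⟨ 0# , 1# , 0# ⟩
  five₁ 4F = ⟨ 0# , 0# , - 1# ⟩
  five₂ 0F = ⟨ 0# , 0# , 1# ⟩
  five₂ 1F = ⟨ 0# , 1# , - 1# ⟩
  five₂ 2F = ⟨ 1# , - 1# , 0# ⟩
  five₂ 3F = ⟨ 1# , - 1# , 1# ⟩
  five₂ 4F = ⟨ 1# , 0# , 0# ⟩
  five₃ 0F = ⟨ 0# , 1# , - 1# ⟩
  five₃ 1F = ⟨ 0# , 0# , 1# ⟩
  five₃ 2F = ⟨ 1# , 0# , 0# ⟩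
  five₃ 3F = ⟨ 1# , 0# , - 1# ⟩
  five₃ 4F = ⟨ 1# , - 1# , 0# ⟩

-- Normal forms need decidable equality of coefficients, which a field need not have,
-- so the coefficients are integers.
module IntegerRingSolver {c ℓ} (R : CommutativeRing c ℓ) where
  open CommutativeRing R
  open import Algebra.Properties.Ring ring using (-0#≈0#; -‿involutive; -‿+-comm; -1*x≈-x)
  open import Algebra.Properties.CommutativeSemigroup +-commutativeSemigroup
    using () renaming (interchange to +-interchange)
  open import Algebra.Properties.CommutativeSemigroup *-commutativeSemigroup
    using () renaming (interchange to *-interchange)
  open import Algebra.Properties.Semiring.Mult.TCOptimised semiring
    using (_×_; 1+×; ×-homo-+; ×1-homo-*; ×-cong)
  open import Relation.Binary.Reasoning.Setoid setoid

  ⟦_⟧ℤ : ℤ → Carrier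
  ⟦ + n ⟧ℤ      = n × 1#
  ⟦ -[1+ n ] ⟧ℤ = - (ℕ.suc n × 1#)

  ⟦_⟧ₛ : Sign → Carrier
  ⟦ Sign.+ ⟧ₛ = 1#
  ⟦ Sign.- ⟧ₛ = - 1#

  ⟦-⟧ : ∀ i → ⟦ ℤ.- i ⟧ℤ ≈ - ⟦ i ⟧ℤ
  ⟦-⟧ (+ 0)         = sym -0#≈0#
  ⟦-⟧ (+ ℕ.suc n)   = refl
  ⟦-⟧ -[1+ n ]      = sym (-‿involutive _)

  ⟦⊖⟧ : ∀ m n → ⟦ m ⊖ n ⟧ℤ ≈ m × 1# - n × 1#
  ⟦⊖⟧ m         0         = sym (trans (+-congˡ -0#≈0#) (+-identityʳ _))
  ⟦⊖⟧ 0         (ℕ.suc n) = sym (+-identityˡ _)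
  ⟦⊖⟧ (ℕ.suc m) (ℕ.suc n) = begin
    ⟦ ℕ.suc m ⊖ ℕ.suc n ⟧ℤ           ≡⟨ ≡.cong ⟦_⟧ℤ (ℤ.[1+m]⊖[1+n]≡m⊖n m n) ⟩
    ⟦ m ⊖ n ⟧ℤ                       ≈⟨ ⟦⊖⟧ m n ⟩
    m × 1# - n × 1#                  ≈⟨ +-identityˡ _ ⟨
    0# + (m × 1# - n × 1#)           ≈⟨ +-congʳ (-‿inverseʳ 1#) ⟨
    (1# - 1#) + (m × 1# - n × 1#)    ≈⟨ +-interchange 1# (- 1#) _ _ ⟩
    (1# + m × 1#) + (- 1# - n × 1#)  ≈⟨ +-congˡ (-‿+-comm 1# _) ⟩
    (1# + m × 1#) - (1# + n × 1#)    ≈⟨ +-cong (1+× m 1#) (-‿cong (1+× n 1#)) ⟨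
    ℕ.suc m × 1# - ℕ.suc n × 1#      ∎

  ⟦+⟧ : ∀ i j → ⟦ i ℤ.+ j ⟧ℤ ≈ ⟦ i ⟧ℤ + ⟦ j ⟧ℤ
  ⟦+⟧ (+ m)    (+ n)    = ×-homo-+ 1# m n
  ⟦+⟧ (+ m)    -[1+ n ] = ⟦⊖⟧ m (ℕ.suc n)
  ⟦+⟧ -[1+ m ] (+ n)    = trans (⟦⊖⟧ n (ℕ.suc m)) (+-comm _ _)
  ⟦+⟧ -[1+ m ] -[1+ n ] = begin
    - (ℕ.suc (ℕ.suc (m ℕ.+ n)) × 1#)         ≈⟨ -‿cong (×-cong (≡.cong ℕ.suc (+-suc m n)) refl) ⟨
    - ((ℕ.suc m ℕ.+ ℕ.suc n) × 1#)           ≈⟨ -‿cong (×-homo-+ 1# (ℕ.suc m) (ℕ.suc n)) ⟩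
    - (ℕ.suc m × 1# + ℕ.suc n × 1#)          ≈⟨ -‿+-comm _ _ ⟨
    - (ℕ.suc m × 1#) + - (ℕ.suc n × 1#)      ∎

  ⟦◃⟧ : ∀ s n → ⟦ s ◃ n ⟧ℤ ≈ ⟦ s ⟧ₛ * (n × 1#)
  ⟦◃⟧ s      0         = sym (zeroʳ _)
  ⟦◃⟧ Sign.+ (ℕ.suc n) = sym (*-identityˡ _)
  ⟦◃⟧ Sign.- (ℕ.suc n) = sym (-1*x≈-x _)

  ⟦*⟧ₛ : ∀ s t → ⟦ s Sign.* t ⟧ₛ ≈ ⟦ s ⟧ₛ * ⟦ t ⟧ₛ
  ⟦*⟧ₛ Sign.+ t      = sym (*-identityˡ _)
  ⟦*⟧ₛ Sign.- Sign.+ = sym (*-identityʳ _)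
  ⟦*⟧ₛ Sign.- Sign.- = sym (trans (-1*x≈-x _) (-‿involutive 1#))

  ⟦⟧-sign-abs : ∀ i → ⟦ i ⟧ℤ ≈ ⟦ sign i ⟧ₛ * (∣ i ∣ × 1#)
  ⟦⟧-sign-abs i = trans (reflexive (≡.cong ⟦_⟧ℤ (≡.sym (ℤ.◃-inverse i)))) (⟦◃⟧ (sign i) ∣ i ∣)

  ⟦*⟧ : ∀ i j → ⟦ i ℤ.* j ⟧ℤ ≈ ⟦ i ⟧ℤ * ⟦ j ⟧ℤ
  ⟦*⟧ i j = begin
    ⟦ i ℤ.* j ⟧ℤ                                                 ≈⟨ ⟦◃⟧ (sign i Sign.* sign j) (∣ i ∣ ℕ.* ∣ j ∣) ⟩
    ⟦ sign i Sign.* sign j ⟧ₛ * ((∣ i ∣ ℕ.* ∣ j ∣) × 1#)          ≈⟨ *-cong (⟦*⟧ₛ (sign i) (sign j)) (×1-homo-* ∣ i ∣ ∣ j ∣) ⟩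
    (⟦ sign i ⟧ₛ * ⟦ sign j ⟧ₛ) * ((∣ i ∣ × 1#) * (∣ j ∣ × 1#))   ≈⟨ *-interchange _ _ _ _ ⟩
    (⟦ sign i ⟧ₛ * (∣ i ∣ × 1#)) * (⟦ sign j ⟧ₛ * (∣ j ∣ × 1#))   ≈⟨ *-cong (⟦⟧-sign-abs i) (⟦⟧-sign-abs j) ⟨
    ⟦ i ⟧ℤ * ⟦ j ⟧ℤ                                               ∎

  ℤ⟶R : ℤ.+-*-rawRing -Raw-AlmostCommutative⟶ fromCommutativeRing R
  ℤ⟶R = record
    { ⟦_⟧    = ⟦_⟧ℤ
    ; +-homo = ⟦+⟧
    ; *-homo = ⟦*⟧
    ; -‿homo = ⟦-⟧
    ; 0-homo = refl
    ; 1-homo = refl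
    }

  ⟦⟧ℤ-≟ : ∀ i j → Maybe (⟦ i ⟧ℤ ≈ ⟦ j ⟧ℤ)
  ⟦⟧ℤ-≟ i j with i ℤ.≟ j
  ... | yes i≡j = just (reflexive (≡.cong ⟦_⟧ℤ i≡j))
  ... | no _    = nothing

  open import Algebra.Solver.Ring ℤ.+-*-rawRing (fromCommutativeRing R) ℤ⟶R ⟦⟧ℤ-≟ public

  -- The solver's syntax is itself a raw ring, so the vector algebra can be
  -- written symbolically; its semantics is then definitionally the same formula.
  polynomialRawRing : ℕ → RawRing _ _
  polynomialRawRing n = record
    { Carrier = Polynomial n
    ; _≈_     = _≡_
    ; _+_     = _:+_
    ; _*_     = _:*_
    ; -_      = :-_
    ; 0#      = con (+ 0)
    ; 1#      = con (+ 1)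
    }

  env : ∀ {k} → Vec (Fin 3 → Carrier) k → Vec Carrier (k ℕ.* 3)
  env []       = []
  env (u ∷ us) = u 0F ∷ u 1F ∷ u 2F ∷ env us

  slot : ∀ {k} → Fin k → Fin 3 → Fin (k ℕ.* 3)
  slot {ℕ.suc k} zero    j = j ↑ˡ (k ℕ.* 3)
  slot {ℕ.suc k} (suc i) j = 3 ↑ʳ slot i j

  module Symbolic (k : ℕ) where

    𝕧 : Fin k → Fin 3 → Polynomial (k ℕ.* 3)
    𝕧 i j = var (slot i j)

    ê : Fin 3 → Fin 3 → Polynomial (k ℕ.* 3)
    ê 0F 0F = con (+ 1)
    ê 1F 1F = con (+ 1)
    ê 2F 2F = con (+ 1)
    ê _  _  = con (+ 0)

module DeterminantTensor {κ ℓ} (K : Field κ ℓ) where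
  open Field K
  open TensorDefs K
  open Vector3 rawRing
  open IntegerRingSolver commRing
  module P {n} = Vector3 (polynomialRawRing n)
  open import Algebra.Properties.Ring ring using (-0#≈0#; -‿distribˡ-*; -‿distribʳ-*; +-inverseʳ-unique)
  open import Relation.Binary.Reasoning.Setoid setoid

  x+a*y≈0⇒y≈-a⁻¹*x : ∀ {a a⁻¹ x y} → a * a⁻¹ ≈ 1# → x + a * y ≈ 0# → y ≈ - (a⁻¹ * x)
  x+a*y≈0⇒y≈-a⁻¹*x {a} {a⁻¹} {x} {y} aa⁻¹≈1 x+ay≈0 = begin
    y                ≈⟨ *-identityˡ y ⟨
    1# * y           ≈⟨ *-congʳ aa⁻¹≈1 ⟨
    a * a⁻¹ * y      ≈⟨ *-congʳ (*-comm a a⁻¹) ⟩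
    a⁻¹ * a * y      ≈⟨ *-assoc a⁻¹ a y ⟩
    a⁻¹ * (a * y)    ≈⟨ *-congˡ (+-inverseʳ-unique x (a * y) x+ay≈0) ⟩
    a⁻¹ * - x        ≈⟨ -‿distribʳ-* a⁻¹ x ⟨
    - (a⁻¹ * x)      ∎

  x*y≈0⇒y≈0 : ∀ {x y} → x ≉ 0# → x * y ≈ 0# → y ≈ 0#
  x*y≈0⇒y≈0 {x} x≉0 xy≈0 with inverse x x≉0
  ... | x⁻¹ , xx⁻¹≈1 = begin
    _                ≈⟨ x+a*y≈0⇒y≈-a⁻¹*x xx⁻¹≈1 (trans (+-identityˡ _) xy≈0) ⟩
    - (x⁻¹ * 0#)     ≈⟨ -‿cong (zeroʳ x⁻¹) ⟩
    - 0#             ≈⟨ -0#≈0# ⟩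
    0#               ∎

  zero-combination : ∀ p q r → 0# * p + 0# * q + 0# * r ≈ 0#
  zero-combination = solve 3 (λ p q r → con (+ 0) :* p :+ con (+ 0) :* q :+ con (+ 0) :* r := con (+ 0)) refl

  ·-comm : ∀ u v → u · v ≈ v · u
  ·-comm u v = prove (env (u ∷ v ∷ [])) (𝕧 0F P.· 𝕧 1F) (𝕧 1F P.· 𝕧 0F) refl
    where open Symbolic 2

  ·-congˡ : ∀ u {v w} → (∀ i → v i ≈ w i) → u · v ≈ u · w
  ·-congˡ u v≈w = +-cong (+-cong (*-congˡ (v≈w 0F)) (*-congˡ (v≈w 1F))) (*-congˡ (v≈w 2F))

  ·-distribˡ-+ : ∀ u v w → u · (λ i → v i + w i) ≈ u · v + u · w
  ·-distribˡ-+ u v w = prove (env (u ∷ v ∷ w ∷ []))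
    (𝕧 0F P.· (λ i → 𝕧 1F i :+ 𝕧 2F i)) ((𝕧 0F P.· 𝕧 1F) :+ (𝕧 0F P.· 𝕧 2F)) refl
    where open Symbolic 3

  ·-negʳ : ∀ u v → u · (λ i → - v i) ≈ - (u · v)
  ·-negʳ u v = prove (env (u ∷ v ∷ [])) (𝕧 0F P.· (λ i → :- 𝕧 1F i)) (:- (𝕧 0F P.· 𝕧 1F)) refl
    where open Symbolic 2

  ·-zeroʳ : ∀ u → u · (λ _ → 0#) ≈ 0#
  ·-zeroʳ u = prove (env (u ∷ [])) (𝕧 0F P.· (λ _ → con (+ 0))) (con (+ 0)) refl
    where open Symbolic 1

  e·-lookup : ∀ i v → e i · v ≈ v i
  e·-lookup 0F v = prove (env (v ∷ [])) (ê 0F P.· 𝕧 0F) (𝕧 0F 0F) refl where open Symbolic 1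
  e·-lookup 1F v = prove (env (v ∷ [])) (ê 1F P.· 𝕧 0F) (𝕧 0F 1F) refl where open Symbolic 1
  e·-lookup 2F v = prove (env (v ∷ [])) (ê 2F P.· 𝕧 0F) (𝕧 0F 2F) refl where open Symbolic 1

  []-cycle : ∀ u v w → [ u , v , w ] ≈ [ v , w , u ]
  []-cycle u v w = prove (env (u ∷ v ∷ w ∷ []))
    P.[ 𝕧 0F , 𝕧 1F , 𝕧 2F ] P.[ 𝕧 1F , 𝕧 2F , 𝕧 0F ] refl
    where open Symbolic 3

  []-antisymʳ : ∀ u v w → [ u , v , w ] ≈ - [ u , w , v ]
  []-antisymʳ u v w = prove (env (u ∷ v ∷ w ∷ []))
    P.[ 𝕧 0F , 𝕧 1F , 𝕧 2F ] (:- P.[ 𝕧 0F , 𝕧 2F , 𝕧 1F ]) refl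
    where open Symbolic 3

  []-repeat₁₂ : ∀ u v → [ u , u , v ] ≈ 0#
  []-repeat₁₂ u v = prove (env (u ∷ v ∷ [])) P.[ 𝕧 0F , 𝕧 0F , 𝕧 1F ] (con (+ 0)) refl
    where open Symbolic 2

  []-repeat₁₃ : ∀ u v → [ u , v , u ] ≈ 0#
  []-repeat₁₃ u v = prove (env (u ∷ v ∷ [])) P.[ 𝕧 0F , 𝕧 1F , 𝕧 0F ] (con (+ 0)) refl
    where open Symbolic 2

  []-repeat₂₃ : ∀ u v → [ u , v , v ] ≈ 0#
  []-repeat₂₃ u v = prove (env (u ∷ v ∷ [])) P.[ 𝕧 0F , 𝕧 1F , 𝕧 1F ] (con (+ 0)) refl
    where open Symbolic 2

  [e₁,e₂,e₃]≈1 : [ e i₁ , e i₂ , e i₃ ] ≈ 1#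
  [e₁,e₂,e₃]≈1 = prove [] P.[ ê 0F , ê 1F , ê 2F ] (con (+ 1)) refl
    where open Symbolic 0

  []-cramer : ∀ a₀ a₁ a₂ b y →
    [ a₀ , a₁ , a₂ ] * (y · b) ≈
      [ a₁ , a₂ , b ] * (y · a₀) + [ a₂ , a₀ , b ] * (y · a₁) + [ a₀ , a₁ , b ] * (y · a₂)
  []-cramer a₀ a₁ a₂ b y = prove (env (a₀ ∷ a₁ ∷ a₂ ∷ b ∷ y ∷ []))
    (P.[ 𝕧 0F , 𝕧 1F , 𝕧 2F ] :* (𝕧 4F P.· 𝕧 3F))
    (P.[ 𝕧 1F , 𝕧 2F , 𝕧 3F ] :* (𝕧 4F P.· 𝕧 0F) :+ P.[ 𝕧 2F , 𝕧 0F , 𝕧 3F ] :* (𝕧 4F P.· 𝕧 1F)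
      :+ P.[ 𝕧 0F , 𝕧 1F , 𝕧 3F ] :* (𝕧 4F P.· 𝕧 2F))
    refl
    where open Symbolic 5

  ·-via-[] : ∀ x w →
    x · w ≈ [ x , e i₂ , e i₃ ] * w i₁ + [ x , e i₃ , e i₁ ] * w i₂ + [ x , e i₁ , e i₂ ] * w i₃
  ·-via-[] x w = prove (env (x ∷ w ∷ []))
    (𝕧 0F P.· 𝕧 1F)
    (P.[ 𝕧 0F , ê 1F , ê 2F ] :* 𝕧 1F 0F :+ P.[ 𝕧 0F , ê 2F , ê 0F ] :* 𝕧 1F 1F
      :+ P.[ 𝕧 0F , ê 0F , ê 1F ] :* 𝕧 1F 2F)
    refl
    where open Symbolic 2

  []-leibniz : ∀ x y z →
    x i₁ * y i₂ * z i₃ + (- (x i₁ * y i₃ * z i₂) + (- (x i₂ * y i₁ * z i₃)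
      + (x i₂ * y i₃ * z i₁ + (x i₃ * y i₁ * z i₂ + - (x i₃ * y i₂ * z i₁)))))
    ≈ [ x , y , z ]
  []-leibniz x y z = prove (env (x ∷ y ∷ z ∷ []))
    (t 0F 1F 2F :+ (:- t 0F 2F 1F :+ (:- t 1F 0F 2F :+ (t 1F 2F 0F :+ (t 2F 0F 1F :+ :- t 2F 1F 0F)))))
    P.[ 𝕧 0F , 𝕧 1F , 𝕧 2F ]
    refl
    where
    open Symbolic 3
    t : Fin 3 → Fin 3 → Fin 3 → Polynomial 9
    t i j k = 𝕧 0F i :* 𝕧 1F j :* 𝕧 2F k

  -- Opaque, so that T can be inferred from ⟪ T ⟫ x y z.
  opaque
    ⟪_⟫ : Tensor → Vec3 → Vec3 → Vec3 → Carrier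
    ⟪ T ⟫ x y z = x · λ i → y · λ j → z · T i j

    ⟪⟫-cong : ∀ {S T} → S ≋ T → ∀ x y z → ⟪ S ⟫ x y z ≈ ⟪ T ⟫ x y z
    ⟪⟫-cong S≋T x y z = ·-congˡ x λ i → ·-congˡ y λ j → ·-congˡ z λ k → S≋T i j k

    ⟪⊕⟫ : ∀ S T x y z → ⟪ S ⊕ T ⟫ x y z ≈ ⟪ S ⟫ x y z + ⟪ T ⟫ x y z
    ⟪⊕⟫ S T x y z = begin
      ⟪ S ⊕ T ⟫ x y z
        ≈⟨ ·-congˡ x (λ i → ·-congˡ y λ j → ·-distribˡ-+ z (S i j) (T i j)) ⟩
      (x · λ i → y · λ j → z · S i j + z · T i j)
        ≈⟨ ·-congˡ x (λ i → ·-distribˡ-+ y (λ j → z · S i j) (λ j → z · T i j)) ⟩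
      (x · λ i → (y · λ j → z · S i j) + (y · λ j → z · T i j))
        ≈⟨ ·-distribˡ-+ x (λ i → y · λ j → z · S i j) (λ i → y · λ j → z · T i j) ⟩
      ⟪ S ⟫ x y z + ⟪ T ⟫ x y z ∎

    ⟪⊖⟫ : ∀ T x y z → ⟪ ⊖ T ⟫ x y z ≈ - ⟪ T ⟫ x y z
    ⟪⊖⟫ T x y z = begin
      ⟪ ⊖ T ⟫ x y z                     ≈⟨ ·-congˡ x (λ i → ·-congˡ y λ j → ·-negʳ z (T i j)) ⟩
      (x · λ i → y · λ j → - (z · T i j)) ≈⟨ ·-congˡ x (λ i → ·-negʳ y λ j → z · T i j) ⟩
      (x · λ i → - (y · λ j → z · T i j)) ≈⟨ ·-negʳ x (λ i → y · λ j → z · T i j) ⟩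
      - ⟪ T ⟫ x y z                     ∎

    ⟪zeroT⟫ : ∀ x y z → ⟪ zeroT ⟫ x y z ≈ 0#
    ⟪zeroT⟫ x y z = begin
      ⟪ zeroT ⟫ x y z         ≈⟨ ·-congˡ x (λ i → ·-congˡ y λ j → ·-zeroʳ z) ⟩
      (x · λ i → y · λ _ → 0#) ≈⟨ ·-congˡ x (λ i → ·-zeroʳ y) ⟩
      (x · λ _ → 0#)           ≈⟨ ·-zeroʳ x ⟩
      0#                       ∎

    ⟪⊗⟫ : ∀ u v w x y z → ⟪ u ⊗ v ⊗ w ⟫ x y z ≈ (x · u) * (y · v) * (z · w)
    ⟪⊗⟫ u v w x y z = prove (env (u ∷ v ∷ w ∷ x ∷ y ∷ z ∷ []))
      (𝕧 3F P.· λ i → 𝕧 4F P.· λ j → 𝕧 5F P.· λ k → 𝕧 0F i :* 𝕧 1F j :* 𝕧 2F k)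
      ((𝕧 3F P.· 𝕧 0F) :* (𝕧 4F P.· 𝕧 1F) :* (𝕧 5F P.· 𝕧 2F))
      refl
      where open Symbolic 6

    ⟪⟫-e : ∀ T i j k → ⟪ T ⟫ (e i) (e j) (e k) ≈ T i j k
    ⟪⟫-e T i j k =
      trans (e·-lookup i λ i′ → e j · λ j′ → e k · T i′ j′) (trans (e·-lookup j λ j′ → e k · T i j′) (e·-lookup k (T i j)))

  ⟪sumSimple⟫ : ∀ n a b c x y z → ⟪ sumSimple n a b c ⟫ x y z ≈ termSum n a b c x y z
  ⟪sumSimple⟫ ℕ.zero    a b c x y z = ⟪zeroT⟫ x y z
  ⟪sumSimple⟫ (ℕ.suc n) a b c x y z = trans (⟪⊕⟫ _ _ x y z)
    (+-cong (⟪⊗⟫ _ _ _ x y z) (⟪sumSimple⟫ n (a ∘ suc) (b ∘ suc) (c ∘ suc) x y z))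

  termSum-e : ∀ n a b c i j k → termSum n a b c (e i) (e j) (e k) ≈ sumSimple n a b c i j k
  termSum-e ℕ.zero    a b c i j k = refl
  termSum-e (ℕ.suc n) a b c i j k =
    +-cong (*-cong (*-cong (e·-lookup i (a 0F)) (e·-lookup j (b 0F))) (e·-lookup k (c 0F))) (termSum-e n (a ∘ suc) (b ∘ suc) (c ∘ suc) i j k)

  ⟪e⊗e⊗e⟫ : ∀ i j k x y z → ⟪ e i ⊗ e j ⊗ e k ⟫ x y z ≈ x i * y j * z k
  ⟪e⊗e⊗e⟫ i j k x y z = trans (⟪⊗⟫ _ _ _ x y z)
    (*-cong (*-cong (trans (·-comm x (e i)) (e·-lookup i x)) (trans (·-comm y (e j)) (e·-lookup j y))) (trans (·-comm z (e k)) (e·-lookup k z)))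

  ⟪⊖e⊗e⊗e⟫ : ∀ i j k x y z → ⟪ ⊖ (e i ⊗ e j ⊗ e k) ⟫ x y z ≈ - (x i * y j * z k)
  ⟪⊖e⊗e⊗e⟫ i j k x y z = trans (⟪⊖⟫ _ x y z) (-‿cong (⟪e⊗e⊗e⟫ i j k x y z))

  ⟪det₃⟫ : ∀ x y z → ⟪ det₃ ⟫ x y z ≈ [ x , y , z ]
  ⟪det₃⟫ x y z = trans
    (pos i₁ i₂ i₃ ⟨⊕⟩ neg i₁ i₃ i₂ ⟨⊕⟩ neg i₂ i₁ i₃ ⟨⊕⟩ pos i₂ i₃ i₁ ⟨⊕⟩ pos i₃ i₁ i₂ ⟨⊕⟩ neg i₃ i₂ i₁)
    ([]-leibniz x y z)
    where
    infixr 5 _⟨⊕⟩_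
    _⟨⊕⟩_ : ∀ {S T p q} → ⟪ S ⟫ x y z ≈ p → ⟪ T ⟫ x y z ≈ q → ⟪ S ⊕ T ⟫ x y z ≈ p + q
    S≈p ⟨⊕⟩ T≈q = trans (⟪⊕⟫ _ _ x y z) (+-cong S≈p T≈q)
    pos : ∀ i j k → ⟪ e i ⊗ e j ⊗ e k ⟫ x y z ≈ x i * y j * z k
    pos i j k = ⟪e⊗e⊗e⟫ i j k x y z
    neg : ∀ i j k → ⟪ ⊖ (e i ⊗ e j ⊗ e k) ⟫ x y z ≈ - (x i * y j * z k)
    neg i j k = ⟪⊖e⊗e⊗e⟫ i j k x y z

  -- A record rather than a Π-type, so that a, b, c can be inferred from a proof.
  record Decomposes (n : ℕ) (a b c : Fin n → Vec3) : Set (κ ⊔ ℓ) where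
    constructor decomposition
    field
      []≈termSum : ∀ x y z → [ x , y , z ] ≈ termSum n a b c x y z
  open Decomposes

  five-decomposes : Decomposes 5 five₁ five₂ five₃
  five-decomposes = decomposition λ x y z → prove (env (x ∷ y ∷ z ∷ []))
    P.[ 𝕧 0F , 𝕧 1F , 𝕧 2F ] (P.termSum 5 P.five₁ P.five₂ P.five₃ (𝕧 0F) (𝕧 1F) (𝕧 2F)) refl
    where open Symbolic 3

  ≋sumSimple⇒decomposes : ∀ {n a b c} → det₃ ≋ sumSimple n a b c → Decomposes n a b c
  ≋sumSimple⇒decomposes {n} {a} {b} {c} det₃≋ = decomposition λ x y z → begin
    [ x , y , z ]                    ≈⟨ ⟪det₃⟫ x y z ⟨
    ⟪ det₃ ⟫ x y z                   ≈⟨ ⟪⟫-cong det₃≋ x y z ⟩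
    ⟪ sumSimple n a b c ⟫ x y z      ≈⟨ ⟪sumSimple⟫ n a b c x y z ⟩
    termSum n a b c x y z            ∎

  decomposes⇒≋sumSimple : ∀ {n a b c} → Decomposes n a b c → det₃ ≋ sumSimple n a b c
  decomposes⇒≋sumSimple {n} {a} {b} {c} dec i j k = begin
    det₃ i j k                             ≈⟨ ⟪⟫-e det₃ i j k ⟨
    ⟪ det₃ ⟫ (e i) (e j) (e k)             ≈⟨ ⟪det₃⟫ (e i) (e j) (e k) ⟩
    [ e i , e j , e k ]                    ≈⟨ []≈termSum dec (e i) (e j) (e k) ⟩
    termSum n a b c (e i) (e j) (e k)      ≈⟨ termSum-e n a b c i j k ⟩
    sumSimple n a b c i j k                ∎

  -- Alternating forms of rank at most two

  alternating-factorised⇒square≈0 : ∀ {a} {A : Set a} (B : A → A → Carrier) {f g : A → Carrier} →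
    (∀ y → B y y ≈ 0#) → (∀ y z → B y z ≈ - B z y) → (∀ y z → B y z ≈ f y * g z) →
    ∀ y z → B y z * B y z ≈ 0#
  alternating-factorised⇒square≈0 B {f} {g} B-alt B-antisym B≈fg y z = begin
    B y z * B y z                ≈⟨ *-congˡ (B-antisym y z) ⟩
    B y z * - B z y              ≈⟨ -‿distribʳ-* (B y z) (B z y) ⟨
    - (B y z * B z y)            ≈⟨ -‿cong (*-cong (B≈fg y z) (B≈fg z y)) ⟩
    - ((f y * g z) * (f z * g y)) ≈⟨ -‿cong (swap (f y) (g z) (f z) (g y)) ⟩
    - ((f y * g y) * (f z * g z)) ≈⟨ -‿cong (*-cong (B≈fg y y) (B≈fg z z)) ⟨
    - (B y y * B z z)            ≈⟨ -‿cong (*-congʳ (B-alt y)) ⟩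
    - (0# * B z z)               ≈⟨ -‿cong (zeroˡ (B z z)) ⟩
    - 0#                         ≈⟨ -0#≈0# ⟩
    0#                           ∎
    where
    swap : ∀ p q r s → (p * q) * (r * s) ≈ (p * s) * (r * q)
    swap = solve 4 (λ p q r s → (p :* q) :* (r :* s) := (p :* s) :* (r :* q)) refl

  Null : Vec3 → Set (κ ⊔ ℓ)
  Null x = ∀ w → x · w ≈ 0#

  [x,eᵢ,eⱼ]≈0⇒null : ∀ x → [ x , e i₂ , e i₃ ] ≈ 0# → [ x , e i₃ , e i₁ ] ≈ 0# → [ x , e i₁ , e i₂ ] ≈ 0# → Null x
  [x,eᵢ,eⱼ]≈0⇒null x h₁ h₂ h₃ w = begin
    x · w                              ≈⟨ ·-via-[] x w ⟩
    _                                  ≈⟨ +-cong (+-cong (*-congʳ h₁) (*-congʳ h₂)) (*-congʳ h₃) ⟩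
    0# * w i₁ + 0# * w i₂ + 0# * w i₃ ≈⟨ zero-combination (w i₁) (w i₂) (w i₃) ⟩
    0#                                 ∎

  factorised⇒¬¬null : ∀ x w {f g : Vec3 → Carrier} →
    (∀ y z → [ x , y , z ] ≈ f y * g z) → ¬ ¬ (x · w ≈ 0#)
  factorised⇒¬¬null x w x≈fg x·w≉0 =
    vanishes (e i₂) (e i₃) λ h₁ → vanishes (e i₃) (e i₁) λ h₂ → vanishes (e i₁) (e i₂) λ h₃ →
    x·w≉0 ([x,eᵢ,eⱼ]≈0⇒null x h₁ h₂ h₃ w)
    where
    vanishes : ∀ y z → ¬ ¬ ([ x , y , z ] ≈ 0#)
    vanishes y z ≉0 = ≉0 (x*y≈0⇒y≈0 ≉0
      (alternating-factorised⇒square≈0 [ x ,_,_] ([]-repeat₂₃ x) ([]-antisymʳ x) x≈fg y z))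

  two-term⇒¬¬f₂x≈0 : ∀ x w {f₁ g₁ f₂ g₂ : Vec3 → Carrier} → x · w ≉ 0# →
    (∀ y z → [ x , y , z ] ≈ f₁ y * g₁ z + f₂ y * g₂ z) → ¬ ¬ (f₂ x ≈ 0#)
  two-term⇒¬¬f₂x≈0 x w {f₁} {g₁} {f₂} {g₂} x·w≉0 split f₂x≉0 with inverse (f₂ x) f₂x≉0
  ... | ι , f₂xι≈1 = factorised⇒¬¬null x w factorised x·w≉0
    where
    μ : Carrier
    μ = - (ι * f₁ x)

    g₂≈μg₁ : ∀ z → g₂ z ≈ μ * g₁ z
    g₂≈μg₁ z = begin
      g₂ z                   ≈⟨ x+a*y≈0⇒y≈-a⁻¹*x f₂xι≈1 (trans (sym (split x z)) ([]-repeat₁₂ x z)) ⟩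
      - (ι * (f₁ x * g₁ z))  ≈⟨ -‿cong (*-assoc ι (f₁ x) (g₁ z)) ⟨
      - (ι * f₁ x * g₁ z)    ≈⟨ -‿distribˡ-* (ι * f₁ x) (g₁ z) ⟩
      μ * g₁ z               ∎

    factorised : ∀ y z → [ x , y , z ] ≈ (f₁ y + μ * f₂ y) * g₁ z
    factorised y z = begin
      [ x , y , z ]                  ≈⟨ split y z ⟩
      f₁ y * g₁ z + f₂ y * g₂ z      ≈⟨ +-congˡ (*-congˡ (g₂≈μg₁ z)) ⟩
      f₁ y * g₁ z + f₂ y * (μ * g₁ z) ≈⟨ collect (f₁ y) (f₂ y) μ (g₁ z) ⟩
      (f₁ y + μ * f₂ y) * g₁ z       ∎
      where
      collect : ∀ p q k g → p * g + q * (k * g) ≈ (p + k * q) * g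
      collect = solve 4 (λ p q k g → p :* g :+ q :* (k :* g) := (p :+ k :* q) :* g) refl

  -- Four-term decompositions

  rotate₃ rotate₄ : Fin 4 → Fin 4
  rotate₃ 0F = 1F
  rotate₃ 1F = 2F
  rotate₃ 2F = 0F
  rotate₃ 3F = 3F
  rotate₄ 0F = 1F
  rotate₄ 1F = 2F
  rotate₄ 2F = 3F
  rotate₄ 3F = 0F

  decomposes-rotate₃ : ∀ {a b c} → Decomposes 4 a b c → Decomposes 4 (a ∘ rotate₃) (b ∘ rotate₃) (c ∘ rotate₃)
  decomposes-rotate₃ {a} {b} {c} dec = decomposition λ x y z →
    let t : Fin 4 → Carrier
        t i = (x · a i) * (y · b i) * (z · c i)
    in trans ([]≈termSum dec x y z) (permute (t 0F) (t 1F) (t 2F) (t 3F))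
    where
    permute : ∀ p q r s → p + (q + (r + (s + 0#))) ≈ q + (r + (p + (s + 0#)))
    permute = solve 4 (λ p q r s → p :+ (q :+ (r :+ (s :+ con (+ 0)))) := q :+ (r :+ (p :+ (s :+ con (+ 0))))) refl

  decomposes-rotate₄ : ∀ {a b c} → Decomposes 4 a b c → Decomposes 4 (a ∘ rotate₄) (b ∘ rotate₄) (c ∘ rotate₄)
  decomposes-rotate₄ {a} {b} {c} dec = decomposition λ x y z →
    let t : Fin 4 → Carrier
        t i = (x · a i) * (y · b i) * (z · c i)
    in trans ([]≈termSum dec x y z) (permute (t 0F) (t 1F) (t 2F) (t 3F))
    where
    permute : ∀ p q r s → p + (q + (r + (s + 0#))) ≈ q + (r + (s + (p + 0#)))
    permute = solve 4 (λ p q r s → p :+ (q :+ (r :+ (s :+ con (+ 0)))) := q :+ (r :+ (s :+ (p :+ con (+ 0))))) refl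

  termSum-orthogonal : ∀ n a b c x y z → (∀ t → x · a t ≈ 0#) → termSum n a b c x y z ≈ 0#
  termSum-orthogonal ℕ.zero    a b c x y z x⊥a = refl
  termSum-orthogonal (ℕ.suc n) a b c x y z x⊥a = begin
    (x · a 0F) * (y · b 0F) * (z · c 0F) + termSum n (a ∘ suc) (b ∘ suc) (c ∘ suc) x y z
      ≈⟨ +-cong (*-congʳ (*-congʳ (x⊥a 0F))) (termSum-orthogonal n (a ∘ suc) (b ∘ suc) (c ∘ suc) x y z (x⊥a ∘ suc)) ⟩
    0# * (y · b 0F) * (z · c 0F) + 0#
      ≈⟨ solve 2 (λ p q → con (+ 0) :* p :* q :+ con (+ 0) := con (+ 0)) refl (y · b 0F) (z · c 0F) ⟩
    0# ∎

  termSum₄-slice : ∀ a b c x y z → x · a 0F ≈ 0# → x · a 1F ≈ 0# →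
    termSum 4 a b c x y z ≈ (y · b 2F) * ((x · a 2F) * (z · c 2F)) + (y · b 3F) * ((x · a 3F) * (z · c 3F))
  termSum₄-slice a b c x y z x⊥a₀ x⊥a₁ = trans
    (+-cong (*-congʳ (*-congʳ x⊥a₀)) (+-congʳ (*-congʳ (*-congʳ x⊥a₁))))
    (slice (y · b 0F) (z · c 0F) (y · b 1F) (z · c 1F) (x · a 2F) (y · b 2F) (z · c 2F) (x · a 3F) (y · b 3F) (z · c 3F))
    where
    slice : ∀ q₀ r₀ q₁ r₁ p₂ q₂ r₂ p₃ q₃ r₃ →
      0# * q₀ * r₀ + (0# * q₁ * r₁ + (p₂ * q₂ * r₂ + (p₃ * q₃ * r₃ + 0#))) ≈ q₂ * (p₂ * r₂) + q₃ * (p₃ * r₃)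
    slice = solve 10 (λ q₀ r₀ q₁ r₁ p₂ q₂ r₂ p₃ q₃ r₃ →
      con (+ 0) :* q₀ :* r₀ :+ (con (+ 0) :* q₁ :* r₁ :+ (p₂ :* q₂ :* r₂ :+ (p₃ :* q₃ :* r₃ :+ con (+ 0))))
        := q₂ :* (p₂ :* r₂) :+ q₃ :* (p₃ :* r₃)) refl

  module _ {a b c : Fin 4 → Vec3} (dec : Decomposes 4 a b c) where

    private
      x₀₁ : Vec3
      x₀₁ = a 0F ⨯ a 1F

    slice-a₀⨯a₁ : ∀ y z → [ x₀₁ , y , z ] ≈
      (y · b 2F) * ((x₀₁ · a 2F) * (z · c 2F)) + (y · b 3F) * ((x₀₁ · a 3F) * (z · c 3F))
    slice-a₀⨯a₁ y z = trans ([]≈termSum dec x₀₁ y z) (termSum₄-slice a b c x₀₁ y z ([]-repeat₁₃ (a 0F) (a 1F)) ([]-repeat₂₃ (a 0F) (a 1F)))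

    orthogonal⇒degenerate : ∀ x → (∀ t → x · a t ≈ 0#) → ∀ y z → [ x , y , z ] ≈ 0#
    orthogonal⇒degenerate x x⊥a y z = trans ([]≈termSum dec x y z) (termSum-orthogonal 4 a b c x y z x⊥a)

    orthogonal⇒null : ∀ x → (∀ t → x · a t ≈ 0#) → Null x
    orthogonal⇒null x x⊥a =
      [x,eᵢ,eⱼ]≈0⇒null x (degenerate (e i₂) (e i₃)) (degenerate (e i₃) (e i₁)) (degenerate (e i₁) (e i₂))
      where
      degenerate : ∀ y z → [ x , y , z ] ≈ 0#
      degenerate = orthogonal⇒degenerate x x⊥a

    independent⇒¬¬[a₀,a₁,b₃]≈0 : [ a 0F , a 1F , a 2F ] ≉ 0# → ¬ ¬ ([ a 0F , a 1F , b 3F ] ≈ 0#)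
    independent⇒¬¬[a₀,a₁,b₃]≈0 D≉0 = two-term⇒¬¬f₂x≈0 x₀₁ (a 2F) D≉0 slice-a₀⨯a₁

  []≈0-cycle : ∀ u v w → [ u , v , w ] ≈ 0# → [ v , w , u ] ≈ 0#
  []≈0-cycle u v w h = trans (sym ([]-cycle u v w)) h

  []≈0-swapʳ : ∀ u v w → [ u , v , w ] ≈ 0# → [ u , w , v ] ≈ 0#
  []≈0-swapʳ u v w h = trans ([]-antisymʳ u w v) (trans (-‿cong h) -0#≈0#)

  independent-case : ∀ {a b c} → Decomposes 4 a b c → [ a 0F , a 1F , a 2F ] ≉ 0# → ⊥
  independent-case {a} {b} {c} dec D≉0 =
    independent⇒¬¬[a₀,a₁,b₃]≈0 dec D≉0 λ h₀₁ →
    independent⇒¬¬[a₀,a₁,b₃]≈0 dec′ (D≉0 ∘ []≈0-cycle (a 2F) (a 0F) (a 1F) ∘ []≈0-cycle (a 1F) (a 2F) (a 0F)) λ h₁₂ →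
    independent⇒¬¬[a₀,a₁,b₃]≈0 dec″ (D≉0 ∘ []≈0-cycle (a 2F) (a 0F) (a 1F)) λ h₂₀ →
    factorised⇒¬¬null (a 0F ⨯ a 1F) (a 2F) (factorised h₁₂ h₂₀ h₀₁) D≉0
    where
    dec′ : Decomposes 4 (a ∘ rotate₃) (b ∘ rotate₃) (c ∘ rotate₃)
    dec′ = decomposes-rotate₃ dec
    dec″ : Decomposes 4 (a ∘ rotate₃ ∘ rotate₃) (b ∘ rotate₃ ∘ rotate₃) (c ∘ rotate₃ ∘ rotate₃)
    dec″ = decomposes-rotate₃ dec′

    module _ (h₁₂ : [ a 1F , a 2F , b 3F ] ≈ 0#) (h₂₀ : [ a 2F , a 0F , b 3F ] ≈ 0#)
             (h₀₁ : [ a 0F , a 1F , b 3F ] ≈ 0#) where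

      b₃-null : ∀ y → y · b 3F ≈ 0#
      b₃-null y = x*y≈0⇒y≈0 D≉0 (begin
        [ a 0F , a 1F , a 2F ] * (y · b 3F)
          ≈⟨ []-cramer (a 0F) (a 1F) (a 2F) (b 3F) y ⟩
        [ a 1F , a 2F , b 3F ] * (y · a 0F) + [ a 2F , a 0F , b 3F ] * (y · a 1F) + [ a 0F , a 1F , b 3F ] * (y · a 2F)
          ≈⟨ +-cong (+-cong (*-congʳ h₁₂) (*-congʳ h₂₀)) (*-congʳ h₀₁) ⟩
        0# * (y · a 0F) + 0# * (y · a 1F) + 0# * (y · a 2F)
          ≈⟨ zero-combination (y · a 0F) (y · a 1F) (y · a 2F) ⟩
        0# ∎)

      factorised : ∀ y z → [ a 0F ⨯ a 1F , y , z ] ≈ (y · b 2F) * ((a 0F ⨯ a 1F · a 2F) * (z · c 2F))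
      factorised y z = begin
        [ a 0F ⨯ a 1F , y , z ]      ≈⟨ slice-a₀⨯a₁ dec y z ⟩
        p + (y · b 3F) * q           ≈⟨ +-congˡ (*-congʳ (b₃-null y)) ⟩
        p + 0# * q                   ≈⟨ +-congˡ (zeroˡ q) ⟩
        p + 0#                       ≈⟨ +-identityʳ p ⟩
        p                            ∎
        where
        p = (y · b 2F) * ((a 0F ⨯ a 1F · a 2F) * (z · c 2F))
        q = (a 0F ⨯ a 1F · a 3F) * (z · c 3F)

  coplanar⇒null : ∀ {a b c} → Decomposes 4 a b c →
    [ a 0F , a 1F , a 2F ] ≈ 0# → [ a 2F , a 3F , a 0F ] ≈ 0# → [ a 3F , a 0F , a 1F ] ≈ 0# → Null (a 0F)
  coplanar⇒null {a} dec h₀₁₂ h₂₃₀ h₃₀₁ =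
    [x,eᵢ,eⱼ]≈0⇒null (a 0F) (vanishes (e i₂) (e i₃)) (vanishes (e i₃) (e i₁)) (vanishes (e i₁) (e i₂))
    where
    h₀₁₃ : [ a 0F , a 1F , a 3F ] ≈ 0#
    h₀₁₃ = []≈0-cycle (a 3F) (a 0F) (a 1F) h₃₀₁
    h₀₂₃ : [ a 0F , a 2F , a 3F ] ≈ 0#
    h₀₂₃ = []≈0-cycle (a 3F) (a 0F) (a 2F) ([]≈0-cycle (a 2F) (a 3F) (a 0F) h₂₃₀)

    null-a₀⨯ : ∀ t → Null (a 0F ⨯ a t)
    null-a₀⨯ 0F = []-repeat₁₂ (a 0F)
    null-a₀⨯ 1F = orthogonal⇒null dec (a 0F ⨯ a 1F) λ where
      0F → []-repeat₁₃ (a 0F) (a 1F)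
      1F → []-repeat₂₃ (a 0F) (a 1F)
      2F → h₀₁₂
      3F → h₀₁₃
    null-a₀⨯ 2F = orthogonal⇒null dec (a 0F ⨯ a 2F) λ where
      0F → []-repeat₁₃ (a 0F) (a 2F)
      1F → []≈0-swapʳ (a 0F) (a 1F) (a 2F) h₀₁₂
      2F → []-repeat₂₃ (a 0F) (a 2F)
      3F → h₀₂₃
    null-a₀⨯ 3F = orthogonal⇒null dec (a 0F ⨯ a 3F) λ where
      0F → []-repeat₁₃ (a 0F) (a 3F)
      1F → []≈0-swapʳ (a 0F) (a 1F) (a 3F) h₀₁₃
      2F → []≈0-swapʳ (a 0F) (a 2F) (a 3F) h₀₂₃
      3F → []-repeat₂₃ (a 0F) (a 3F)

    null-⨯a₀ : ∀ u → Null (u ⨯ a 0F)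
    null-⨯a₀ u = orthogonal⇒null dec (u ⨯ a 0F) λ t →
      []≈0-cycle (a t) u (a 0F) ([]≈0-cycle (a 0F) (a t) u (null-a₀⨯ t u))

    vanishes : ∀ v w → [ a 0F , v , w ] ≈ 0#
    vanishes v w = []≈0-cycle w (a 0F) v (null-⨯a₀ w v)

  coplanar-case : ∀ {a b c} → Decomposes 4 a b c →
    [ a 0F , a 1F , a 2F ] ≈ 0# → [ a 1F , a 2F , a 3F ] ≈ 0# →
    [ a 2F , a 3F , a 0F ] ≈ 0# → [ a 3F , a 0F , a 1F ] ≈ 0# → ⊥
  coplanar-case {a} {b} {c} dec h₀ h₁ h₂ h₃ = 0≉1 (begin
    0#                        ≈⟨ orthogonal⇒degenerate dec (e i₁) e₁⊥a (e i₂) (e i₃) ⟨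
    [ e i₁ , e i₂ , e i₃ ]    ≈⟨ [e₁,e₂,e₃]≈1 ⟩
    1#                        ∎)
    where
    dec′ : Decomposes 4 (a ∘ rotate₄) (b ∘ rotate₄) (c ∘ rotate₄)
    dec′ = decomposes-rotate₄ dec
    dec″ : Decomposes 4 (a ∘ rotate₄ ∘ rotate₄) (b ∘ rotate₄ ∘ rotate₄) (c ∘ rotate₄ ∘ rotate₄)
    dec″ = decomposes-rotate₄ dec′
    dec‴ : Decomposes 4 (a ∘ rotate₄ ∘ rotate₄ ∘ rotate₄) (b ∘ rotate₄ ∘ rotate₄ ∘ rotate₄) (c ∘ rotate₄ ∘ rotate₄ ∘ rotate₄)
    dec‴ = decomposes-rotate₄ dec″

    null : ∀ t → Null (a t)
    null 0F = coplanar⇒null dec  h₀ h₂ h₃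
    null 1F = coplanar⇒null dec′ h₁ h₃ h₀
    null 2F = coplanar⇒null dec″ h₂ h₀ h₁
    null 3F = coplanar⇒null dec‴ h₃ h₁ h₂

    e₁⊥a : ∀ t → e i₁ · a t ≈ 0#
    e₁⊥a t = trans (·-comm (e i₁) (a t)) (null t (e i₁))

  -- Equality in K is not decidable; the case split happens under ¬¬, which suffices
  -- because the goal is ⊥.
  no-four-term-decomposition : ∀ {a b c} → ¬ Decomposes 4 a b c
  no-four-term-decomposition dec = ¬¬-excluded-middle λ where
    (no D₀≉0) → independent-case dec D₀≉0
    (yes h₀)  → ¬¬-excluded-middle λ where
      (no D₁≉0) → independent-case (decomposes-rotate₄ dec) D₁≉0
      (yes h₁)  → ¬¬-excluded-middle λ where
        (no D₂≉0) → independent-case (decomposes-rotate₄ (decomposes-rotate₄ dec)) D₂≉0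
        (yes h₂)  → ¬¬-excluded-middle λ where
          (no D₃≉0) → independent-case (decomposes-rotate₄ (decomposes-rotate₄ (decomposes-rotate₄ dec))) D₃≉0
          (yes h₃)  → coplanar-case dec h₀ h₁ h₂ h₃

  SumOfSimple-suc : ∀ {n T} → SumOfSimple n T → SumOfSimple (ℕ.suc n) T
  SumOfSimple-suc {n} {T} (a , b , c , T≋) = zero∷ a , zero∷ b , zero∷ c , λ i j k → begin
    T i j k                                ≈⟨ T≋ i j k ⟩
    sumSimple n a b c i j k                ≈⟨ +-identityˡ _ ⟨
    0# + sumSimple n a b c i j k           ≈⟨ +-congʳ (trans (*-congʳ (zeroˡ 0#)) (zeroˡ 0#)) ⟨
    0# * 0# * 0# + sumSimple n a b c i j k ∎
    where
    zero∷ : (Fin n → Vec3) → Fin (ℕ.suc n) → Vec3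
    zero∷ v zero    = λ _ → 0#
    zero∷ v (suc t) = v t

  SumOfSimple-mono : ∀ {m n T} → m ≤′ n → SumOfSimple m T → SumOfSimple n T
  SumOfSimple-mono ≤′-refl        sum = sum
  SumOfSimple-mono (≤′-step m≤′n) sum = SumOfSimple-suc (SumOfSimple-mono m≤′n sum)

  rank≤5 : SumOfSimple 5 det₃
  rank≤5 = five₁ , five₂ , five₃ , decomposes⇒≋sumSimple five-decomposes

  rank≥5 : ∀ s → s < 5 → ¬ SumOfSimple s det₃
  rank≥5 s s<5 sum with SumOfSimple-mono (≤⇒≤′ (s≤s⁻¹ s<5)) sum
  ... | a , b , c , det₃≋ = no-four-term-decomposition (≋sumSimple⇒decomposes {4} {a} {b} {c} det₃≋)

theorem1p3 : {c ℓ : Level} (K : Field c ℓ) → TensorDefs.HasTensorRank K (TensorDefs.det₃ K) 5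
theorem1p3 K = rank≤5 , rank≥5
  where open DeterminantTensor K
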